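{- If $f:\{0,1\}^n\to\{0,1\}$ is a Boolean function with $\mathsf{mbs}(f)\leq 1$, then there exist $k\ge1$ and sets $S_1,\dots,S_k\subseteq[n]$ such that, as functions on $\{0,1\}^n$, either $f=\mathrm{OMB}(X_{S_1},\dots,X_{S_k})$ or $f=1-\mathrm{OMB}(X_{S_1},\dots,X_{S_k})$.
   Context: For $S\subseteq[n]$, $X_S$ denotes the monomial $\prod_{i\in S}x_i$ (with $X_\emptyset=1$). $\mathrm{OMB}$ (ODD-MAX-BIT) is defined by $\mathrm{OMB}(X_{S_1},\dots,X_{S_k})=\sum_{j=1}^{k}(-1)^{j+1}X_{S_1\cup\cdots\cup S_j}=X_{S_1}-X_{S_1}X_{S_2}+X_{S_1}X_{S_2}X_{S_3}-\cdots$, where products of monomials are taken as Boolean monomials ($X_SX_T=X_{S\cup T}$). For $x\in\{0,1\}^n$, $\mathsf{mbs}(f,x)$ is the maximum number of pairwise disjoint nonempty sets $B\subseteq[n]\setminus\{i:x_i=1\}$ with $f(x^B)\ne f(x)$ ($x^B$ = $x$ with bits in $B$ flipped), and $\mathsf{mbs}(f)=\max_x\mathsf{mbs}(f,x)$. -}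

module Defs where

open import Data.Nat using (ℕ; zero; suc; _≤_)
open import Data.Bool using (Bool; true; false; not; if_then_else_)
open import Data.Fin using (Fin)
open import Data.Fin.Subset using (Subset; _∈_; _∪_; _∩_; Nonempty; Empty; ⊥)
open import Data.Vec using (Vec; []; _∷_; lookup; tabulate)
open import Data.List using (List; length)
open import Data.List.Relation.Unary.All using (All)
open import Data.List.Relation.Unary.AllPairs using (AllPairs)
open import Data.Integer using (ℤ; +_; _+_; _-_; -_)
open import Relation.Binary.PropositionalEquality using (_≡_; _≢_)

-- Inputs: x ∈ {0,1}^n, with true = 1, false = 0.
Input : ℕ → Set
Input n = Vec Bool n

BoolFun : ℕ → Set
BoolFun n = Input n → Bool

flip : ∀ {n} → Input n → Subset n → Input n
flip {n} x B = tabulate λ i → if isIn i B then not (lookup x i) else lookup x i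
  where
  isIn : Fin n → Subset n → Bool
  isIn i S = lookup S i

InZeros : ∀ {n} → Input n → Subset n → Set
InZeros x B = ∀ i → i ∈ B → lookup x i ≡ false

SensBlock : ∀ {n} → BoolFun n → Input n → Subset n → Set
SensBlock f x B = Nonempty B × InZeros x B × (f (flip x B) ≢ f x)
  where open import Data.Product using (_×_)

Disjoint : ∀ {n} → Subset n → Subset n → Set
Disjoint A B = Empty (A ∩ B)

SensFamily : ∀ {n} → BoolFun n → Input n → List (Subset n) → Set
SensFamily f x Bs = All (SensBlock f x) Bs × AllPairs Disjoint Bs
  where open import Data.Product using (_×_)

-- mbs(f) ≤ m : at every x, every family of pairwise disjoint sensitive
-- blocks (a candidate for the maximum defining mbs(f,x)) has size ≤ m.
mbs≤ : ∀ {n} → BoolFun n → ℕ → Set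
mbs≤ {n} f m = ∀ (x : Input n) (Bs : List (Subset n)) → SensFamily f x Bs → length Bs ≤ m

monoB : ∀ {n} → Subset n → Input n → Bool
monoB {n} S x = go S x
  where
  go : ∀ {m} → Subset m → Vec Bool m → Bool
  go [] [] = true
  go (Data.Fin.Subset.outside ∷ S) (_ ∷ x) = go S x
  go (Data.Fin.Subset.inside ∷ S) (b ∷ x) = if b then go S x else false

toℤ : Bool → ℤ
toℤ true = + 1
toℤ false = + 0

-- OMB(X_{S_1},...,X_{S_k})(x) = Σ_{j=1}^k (-1)^{j+1} X_{S_1 ∪ ... ∪ S_j}(x), as an integer.
-- omb U Ss x computes Σ_j (-1)^{j+1} X_{U ∪ S_1 ∪ ... ∪ S_j}(x).
ombFrom : ∀ {n k} → Subset n → Vec (Subset n) k → Input n → ℤ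
ombFrom U [] x = + 0
ombFrom U (S ∷ Ss) x = toℤ (monoB (U ∪ S) x) - ombFrom (U ∪ S) Ss x

OMB : ∀ {n k} → Vec (Subset n) k → Input n → ℤ
OMB Ss x = ombFrom ⊥ Ss x

-- Represent f on the up-set of a set U (inputs are identified with subsets).
-- If f is constant there, the empty OMB does it. Otherwise take a minimal
-- V ⊇ U with f V ≠ f U. With mbs(f) ≤ 1 every x ⊇ U with f x ≠ f U contains V:
-- otherwise f already equals f U on z = V ∩ x, and V ─ z, x ─ z are two
-- disjoint sensitive blocks at z. So above U, f equals f U off the up-set of V,
-- and on it is given by a representation above V ⊋ U, found by well-founded
-- recursion; prepending X_V alternates the sign as in OMB. At U = ∅, prepending
-- X_∅ = 1 makes the list nonempty at the cost of one more sign change.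
module Submission where

open import Defs
open import Data.Bool using (Bool; true; false; not; _≟_)
open import Data.Bool.Properties using (¬-not; not-involutive)
open import Data.Empty using (⊥-elim)
open import Data.Fin.Subset using (Subset; _∪_; _∩_; _─_; _⊆_; _⊂_; _⊃_; _∈_; _∉_; ⊥; Nonempty)
open import Data.Fin.Subset.Induction using (⊂-wellFounded; ⊃-wellFounded)
open import Data.Fin.Subset.Properties
  using (_∈?_; _⊆?_; _⊂?_; anySubset?; drop-∷-⊆; out⊆; in⊆in; ⊆-refl; ⊆-trans; ⊆-antisym; ⊆-min;
         p⊆p∪q; ∪-idem; x∈p∩q⁺; x∈p∩q⁻; p∩q⊆p; p∩q⊆q; x∈p∧x∉q⇒x∈p─q; p─q⊆p)
open import Data.Fin.Properties using (any?)
open import Data.Integer using (ℤ; +_; _-_)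
open import Data.Integer.Tactic.RingSolver using (solve-∀)
open import Data.List using ([]; _∷_)
open import Data.List.Relation.Unary.All using () renaming ([] to []ᵃ; _∷_ to _∷ᵃ_)
open import Data.List.Relation.Unary.AllPairs using () renaming ([] to []ᵖ; _∷_ to _∷ᵖ_)
open import Data.Nat using (ℕ; suc)
open import Data.Nat.Properties using (<-irrefl)
open import Data.Product using (Σ; ∃; _×_; _,_; proj₂)
open import Data.Sum using (_⊎_; inj₁; inj₂)
open import Data.Vec using (Vec; []; _∷_; lookup; here; there)
open import Data.Vec.Properties using (lookup⇒[]=)
open import Function using (_∘_)
open import Induction.WellFounded using (WfRec; module All)
open import Relation.Nullary using (¬_; yes; no)
open import Relation.Nullary.Decidable using (_×-dec_; ¬?; decidable-stable)
open import Relation.Unary using (Pred; Decidable)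
open import Relation.Binary.PropositionalEquality
  using (_≡_; _≢_; refl; sym; trans; cong; cong₂; module ≡-Reasoning)

open ≡-Reasoning

private
  variable
    n k : ℕ

⊈⇒∃∈∉ : {p q : Subset n} → ¬ p ⊆ q → ∃ λ i → i ∈ p × i ∉ q
⊈⇒∃∈∉ {p = p} {q} p⊈q with any? (λ i → (i ∈? p) ×-dec ¬? (i ∈? q))
... | yes witness = witness
... | no none     = ⊥-elim (p⊈q λ {i} i∈p → decidable-stable (i ∈? q) (λ i∉q → none (i , i∈p , i∉q)))

x∈p─q⇒x∉q : ∀ (p q : Subset n) {i} → i ∈ p ─ q → i ∉ q
x∈p─q⇒x∉q (_ ∷ p) (_ ∷ q)    (there i∈) (there i∈q) = x∈p─q⇒x∉q p q i∈ i∈q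
x∈p─q⇒x∉q (_ ∷ p) (true ∷ q) ()          here

x∉p⇒lookup≡false : ∀ (p : Subset n) i → i ∉ p → lookup p i ≡ false
x∉p⇒lookup≡false p i i∉p with lookup p i in eq
... | true  = ⊥-elim (i∉p (lookup⇒[]= i p eq))
... | false = refl

p⊆q⇒p∪q≡q : {p q : Subset n} → p ⊆ q → p ∪ q ≡ q
p⊆q⇒p∪q≡q {p = []}        {[]}    _   = refl
p⊆q⇒p∪q≡q {p = false ∷ p} {b ∷ q} p⊆q = cong (b ∷_) (p⊆q⇒p∪q≡q (drop-∷-⊆ p⊆q))
p⊆q⇒p∪q≡q {p = true ∷ p}  {b ∷ q} p⊆q with p⊆q here
... | here = cong (true ∷_) (p⊆q⇒p∪q≡q (drop-∷-⊆ p⊆q))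

flip-─ : ∀ (z y : Subset n) → flip z (y ─ z) ≡ z ∪ y
flip-─ []          []          = refl
flip-─ (true ∷ z)  (_ ∷ y)     = cong (true ∷_)  (flip-─ z y)
flip-─ (false ∷ z) (false ∷ y) = cong (false ∷_) (flip-─ z y)
flip-─ (false ∷ z) (true ∷ y)  = cong (true ∷_)  (flip-─ z y)

─-∩-disjoint : ∀ (p q : Subset n) → Disjoint (p ─ p ∩ q) (q ─ p ∩ q)
─-∩-disjoint p q (i , i∈both) with x∈p∩q⁻ (p ─ p ∩ q) (q ─ p ∩ q) i∈both
... | i∈p─ , i∈q─ = x∈p─q⇒x∉q p (p ∩ q) i∈p─ (x∈p∩q⁺ (p─q⊆p p (p ∩ q) i∈p─ , p─q⊆p q (p ∩ q) i∈q─))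

⊆⇒monoB≡true : ∀ (S x : Subset n) → S ⊆ x → monoB S x ≡ true
⊆⇒monoB≡true []          []      _   = refl
⊆⇒monoB≡true (false ∷ S) (_ ∷ x) S⊆x = ⊆⇒monoB≡true S x (drop-∷-⊆ S⊆x)
⊆⇒monoB≡true (true ∷ S)  (_ ∷ x) S⊆x with S⊆x here
... | here = ⊆⇒monoB≡true S x (drop-∷-⊆ S⊆x)

monoB≡true⇒⊆ : ∀ (S x : Subset n) → monoB S x ≡ true → S ⊆ x
monoB≡true⇒⊆ []          []          _ = ⊆-refl
monoB≡true⇒⊆ (false ∷ S) (_ ∷ x)     e = out⊆ (monoB≡true⇒⊆ S x e)
monoB≡true⇒⊆ (true ∷ S)  (true ∷ x)  e = in⊆in (monoB≡true⇒⊆ S x e)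
monoB≡true⇒⊆ (true ∷ S)  (false ∷ x) ()

⊈⇒monoB≡false : ∀ (S x : Subset n) → ¬ S ⊆ x → monoB S x ≡ false
⊈⇒monoB≡false S x S⊈x with monoB S x in eq
... | true  = ⊥-elim (S⊈x (monoB≡true⇒⊆ S x eq))
... | false = refl

ombFrom-⊈ : ∀ (W : Subset n) (Ss : Vec (Subset n) k) x → ¬ W ⊆ x → ombFrom W Ss x ≡ + 0
ombFrom-⊈ W []       x W⊈x = refl
ombFrom-⊈ W (S ∷ Ss) x W⊈x = cong₂ (λ b o → toℤ b - o)
  (⊈⇒monoB≡false (W ∪ S) x W∪S⊈x) (ombFrom-⊈ (W ∪ S) Ss x W∪S⊈x)
  where
  W∪S⊈x : ¬ W ∪ S ⊆ x
  W∪S⊈x = W⊈x ∘ ⊆-trans (p⊆p∪q S)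

OMB-⊥∷ : ∀ (Ss : Vec (Subset n) k) x → OMB (⊥ ∷ Ss) x ≡ + 1 - OMB Ss x
OMB-⊥∷ Ss x = begin
  toℤ (monoB (⊥ ∪ ⊥) x) - ombFrom (⊥ ∪ ⊥) Ss x ≡⟨ cong (λ W → toℤ (monoB W x) - ombFrom W Ss x) (∪-idem ⊥) ⟩
  toℤ (monoB ⊥ x) - OMB Ss x                    ≡⟨ cong (λ b → toℤ b - OMB Ss x) (⊆⇒monoB≡true ⊥ x (⊆-min x)) ⟩
  + 1 - OMB Ss x                                ∎

complementIf : Bool → ℤ → ℤ
complementIf false o = o
complementIf true  o = + 1 - o

complementIf-not : ∀ b o → complementIf (not b) o ≡ complementIf b (+ 1 - o)
complementIf-not false o = refl
complementIf-not true  o = sym (1-[1-o]≡o o)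
  where
  1-[1-o]≡o : ∀ o → + 1 - (+ 1 - o) ≡ o
  1-[1-o]≡o = solve-∀

complementIf-⊥∷ : ∀ b (Ss : Vec (Subset n) k) x →
  complementIf b (OMB Ss x) ≡ complementIf (not b) (OMB (⊥ ∷ Ss) x)
complementIf-⊥∷ b Ss x = begin
  complementIf b (OMB Ss x)               ≡⟨ cong (λ c → complementIf c (OMB Ss x)) (sym (not-involutive b)) ⟩
  complementIf (not (not b)) (OMB Ss x)   ≡⟨ complementIf-not (not b) (OMB Ss x) ⟩
  complementIf (not b) (+ 1 - OMB Ss x)   ≡⟨ cong (complementIf (not b)) (sym (OMB-⊥∷ Ss x)) ⟩
  complementIf (not b) (OMB (⊥ ∷ Ss) x)   ∎

complementIf-+0 : ∀ b → toℤ b ≡ complementIf b (+ 0)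
complementIf-+0 false = refl
complementIf-+0 true  = refl

Minimal : Pred (Subset n) _ → Subset n → Set
Minimal P V = P V × (∀ {W} → W ⊂ V → ¬ P W)

∃-minimal : {P : Pred (Subset n) _} → Decidable P → ∀ {y} → P y → ∃ (Minimal P)
∃-minimal {P = P} P? {y} = All.wfRec ⊂-wellFounded _ (λ y → P y → ∃ (Minimal P)) descend y
  where
  descend : ∀ y → WfRec _⊂_ (λ y → P y → ∃ (Minimal P)) y → P y → ∃ (Minimal P)
  descend y smaller Py with anySubset? (λ W → (W ⊂? y) ×-dec P? W)
  ... | yes (W , W⊂y , PW) = smaller W⊂y PW
  ... | no  none           = y , Py , λ W⊂y PW → none (_ , W⊂y , PW)

sensBlock-─ : ∀ (f : BoolFun n) {z V} → z ⊆ V → f V ≢ f z → SensBlock f z (V ─ z)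
sensBlock-─ f {z} {V} z⊆V fV≢fz = nonempty , inZeros , sensitive
  where
  V⊈z : ¬ V ⊆ z
  V⊈z V⊆z = fV≢fz (cong f (⊆-antisym V⊆z z⊆V))
  nonempty : Nonempty (V ─ z)
  nonempty with ⊈⇒∃∈∉ V⊈z
  ... | i , i∈V , i∉z = i , x∈p∧x∉q⇒x∈p─q i∈V i∉z
  inZeros : InZeros z (V ─ z)
  inZeros i i∈ = x∉p⇒lookup≡false z i (x∈p─q⇒x∉q V z i∈)
  sensitive : f (flip z (V ─ z)) ≢ f z
  sensitive rewrite flip-─ z V | p⊆q⇒p∪q≡q z⊆V = fV≢fz

two-blocks-above-∩ : ∀ (f : BoolFun n) {p q} → f p ≢ f (p ∩ q) → f q ≢ f (p ∩ q) →
  SensFamily f (p ∩ q) ((p ─ p ∩ q) ∷ (q ─ p ∩ q) ∷ [])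
two-blocks-above-∩ f {p} {q} fp≢ fq≢ =
  (sensBlock-─ f (p∩q⊆p p q) fp≢ ∷ᵃ sensBlock-─ f (p∩q⊆q p q) fq≢ ∷ᵃ []ᵃ) ,
  ((─-∩-disjoint p q ∷ᵃ []ᵃ) ∷ᵖ []ᵃ ∷ᵖ []ᵖ)

module _ (f : BoolFun n) (mbs≤1 : mbs≤ f 1) where

  ChangesAbove : Subset n → Pred (Subset n) _
  ChangesAbove U W = U ⊆ W × f W ≢ f U

  changesAbove? : ∀ U → Decidable (ChangesAbove U)
  changesAbove? U W = (U ⊆? W) ×-dec ¬? (f W ≟ f U)

  changesAbove⇒⊂ : ∀ {U V} → ChangesAbove U V → U ⊂ V
  changesAbove⇒⊂ (U⊆V , fV≢fU) = U⊆V , ⊈⇒∃∈∉ (λ V⊆U → fV≢fU (cong f (⊆-antisym V⊆U U⊆V)))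

  minimal-change-⊆ : ∀ {U V y} → Minimal (ChangesAbove U) V → ChangesAbove U y → V ⊆ y
  minimal-change-⊆ {U} {V} {y} ((U⊆V , fV≢fU) , minimal) (U⊆y , fy≢fU) with V ⊆? y
  ... | yes V⊆y = V⊆y
  ... | no  V⊈y = ⊥-elim (<-irrefl refl (mbs≤1 (V ∩ y) _ twoBlocks))
    where
    V∩y⊂V : V ∩ y ⊂ V
    V∩y⊂V with ⊈⇒∃∈∉ V⊈y
    ... | i , i∈V , i∉y = p∩q⊆p V y , i , i∈V , i∉y ∘ proj₂ ∘ x∈p∩q⁻ V y
    fV∩y≡fU : f (V ∩ y) ≡ f U
    fV∩y≡fU = decidable-stable (f (V ∩ y) ≟ f U)
      (λ f≢ → minimal V∩y⊂V ((λ i∈U → x∈p∩q⁺ (U⊆V i∈U , U⊆y i∈U)) , f≢))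
    twoBlocks : SensFamily f (V ∩ y) ((V ─ V ∩ y) ∷ (y ─ V ∩ y) ∷ [])
    twoBlocks = two-blocks-above-∩ f
      (λ e → fV≢fU (trans e fV∩y≡fU)) (λ e → fy≢fU (trans e fV∩y≡fU))

  RepresentsAbove : Subset n → Vec (Subset n) k → Set
  RepresentsAbove U Ss = ∀ x → U ⊆ x → toℤ (f x) ≡ complementIf (f U) (ombFrom U Ss x)

  RepresentableAbove : Subset n → Set
  RepresentableAbove U = Σ ℕ λ k → Σ (Vec (Subset n) k) (RepresentsAbove U)

  representsAbove-∷ : ∀ {U V} {Ss : Vec (Subset n) k} →
    Minimal (ChangesAbove U) V → RepresentsAbove V Ss → RepresentsAbove U (V ∷ Ss)
  representsAbove-∷ {U = U} {V} {Ss} minV@((U⊆V , fV≢fU) , _) repV x U⊆x rewrite p⊆q⇒p∪q≡q U⊆V with V ⊆? x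
  ... | yes V⊆x = begin
    toℤ (f x)                                 ≡⟨ repV x V⊆x ⟩
    complementIf (f V) o                      ≡⟨ cong (λ b → complementIf b o) (¬-not fV≢fU) ⟩
    complementIf (not (f U)) o                ≡⟨ complementIf-not (f U) o ⟩
    complementIf (f U) (+ 1 - o)              ≡⟨ cong (λ b → complementIf (f U) (toℤ b - o)) (sym (⊆⇒monoB≡true V x V⊆x)) ⟩
    complementIf (f U) (toℤ (monoB V x) - o)  ∎
    where o = ombFrom V Ss x
  ... | no V⊈x = begin
    toℤ (f x)                                 ≡⟨ cong toℤ fx≡fU ⟩
    toℤ (f U)                                 ≡⟨ complementIf-+0 (f U) ⟩
    complementIf (f U) (+ 0)                  ≡⟨ cong₂ (λ b o → complementIf (f U) (toℤ b - o)) (sym (⊈⇒monoB≡false V x V⊈x)) (sym (ombFrom-⊈ V Ss x V⊈x)) ⟩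
    complementIf (f U) (toℤ (monoB V x) - ombFrom V Ss x) ∎
    where
    fx≡fU : f x ≡ f U
    fx≡fU = decidable-stable (f x ≟ f U) (λ fx≢fU → V⊈x (minimal-change-⊆ minV (U⊆x , fx≢fU)))

  representableAbove : ∀ U → RepresentableAbove U
  representableAbove = All.wfRec ⊃-wellFounded _ RepresentableAbove step
    where
    step : ∀ U → WfRec _⊃_ RepresentableAbove U → RepresentableAbove U
    step U larger with anySubset? (changesAbove? U)
    ... | no noChange = 0 , [] , λ x U⊆x →
      trans (cong toℤ (decidable-stable (f x ≟ f U) (λ fx≢fU → noChange (x , U⊆x , fx≢fU))))
            (complementIf-+0 (f U))
    ... | yes (y , changeAtY) with ∃-minimal (changesAbove? U) changeAtY
    ... | V , minV@(changeAtV , _) with larger (changesAbove⇒⊂ changeAtV)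
    ... | k , Ss , repV = suc k , V ∷ Ss , representsAbove-∷ {Ss = Ss} minV repV

lemma5 : ∀ (n : ℕ) (f : BoolFun n) → mbs≤ f 1 →
    Σ ℕ λ k → Σ (Vec (Subset n) (suc k)) λ Ss →
    (∀ x → toℤ (f x) ≡ OMB Ss x) ⊎ (∀ x → toℤ (f x) ≡ + 1 - OMB Ss x)
lemma5 n f mbs≤1 with representableAbove f mbs≤1 ⊥
... | k , Ss , rep = k , ⊥ ∷ Ss , bySign (not (f ⊥)) λ x → trans (rep x (⊆-min x)) (complementIf-⊥∷ (f ⊥) Ss x)
  where
  bySign : ∀ b → (∀ x → toℤ (f x) ≡ complementIf b (OMB (⊥ ∷ Ss) x)) →
    (∀ x → toℤ (f x) ≡ OMB (⊥ ∷ Ss) x) ⊎ (∀ x → toℤ (f x) ≡ + 1 - OMB (⊥ ∷ Ss) x)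
  bySign false = inj₁
  bySign true  = inj₂
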